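{- For every non-negative integer $L$ and every positive integer $k$, \[ \sum_{j=-L}^{L}\left(\frac{j+1}{3}\right)q^{kj(j-1)}{2L\brack L-j}_q = q^L\sum_{j=-L}^{L}\left(\frac{j+1}{3}\right)q^{kj^2-(k-1)j}{2L\brack L-j}_q. \]
   Context: $(a;q)_n=\prod_{k=0}^{n-1}(1-aq^k)$. The $q$-binomial coefficient is ${m+n\brack m}_q=\frac{(q;q)_{m+n}}{(q;q)_m(q;q)_n}$ for $m,n\ge 0$ and $0$ otherwise. $\left(\frac{a}{3}\right)$ denotes the Jacobi symbol modulo 3: $0$ if $3\mid a$, $1$ if $a\equiv1\pmod 3$, $-1$ if $a\equiv 2\pmod 3$. -}

module Defs where

open import Level using (Level)
open import Data.Nat as ℕ using (ℕ; zero; suc)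
open import Data.Integer as ℤ using (ℤ; +_; ∣_∣)
open import Data.Integer.DivMod using (_%ℕ_)
open import Algebra.Bundles using (CommutativeRing)

module _ {c ℓ : Level} (R : CommutativeRing c ℓ) where
  open CommutativeRing R

  pow : Carrier → ℕ → Carrier
  pow q zero    = 1#
  pow q (suc n) = q * pow q n

  -- Gaussian polynomial [n choose k]_q (0 when k > n), via q-Pascal:
  -- [n+1, k+1] = [n, k] + q^(k+1) [n, k+1]
  qbin : Carrier → ℕ → ℕ → Carrier
  qbin q zero    zero    = 1#
  qbin q zero    (suc k) = 0#
  qbin q (suc n) zero    = 1#
  qbin q (suc n) (suc k) = qbin q n k + pow q (suc k) * qbin q n (suc k)

  jac3 : ℤ → Carrier
  jac3 a with a %ℕ 3
  ... | 0 = 0#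
  ... | 1 = 1#
  ... | _ = - 1#

  sumSym : ℕ → (ℤ → Carrier) → Carrier
  sumSym L f = go (suc (2 ℕ.* L))
    where
    go : ℕ → Carrier
    go zero    = 0#
    go (suc i) = go i + f (+ i ℤ.- + L)

  lhs12 : Carrier → ℕ → ℕ → Carrier
  lhs12 q L k = sumSym L (λ j →
    jac3 (j ℤ.+ ℤ.1ℤ)
      * pow q ∣ + k ℤ.* j ℤ.* (j ℤ.- ℤ.1ℤ) ∣
      * qbin q (2 ℕ.* L) ∣ + L ℤ.- j ∣)

  rhs12 : Carrier → ℕ → ℕ → Carrier
  rhs12 q L k = pow q L * sumSym L (λ j →
    jac3 (j ℤ.+ ℤ.1ℤ)
      * pow q ∣ + k ℤ.* j ℤ.* j ℤ.- (+ k ℤ.- ℤ.1ℤ) ℤ.* j ∣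
      * qbin q (2 ℕ.* L) ∣ + L ℤ.- j ∣)

{-# OPTIONS --safe #-}
module Submission where

-- Write j for the summation index. Since kj² − (k−1)j + L = kj(j−1) + (L + j), the
-- right-hand side is Σ (j+1 / 3) q^(kj(j−1)) q^(L+j) [2L, L−j], which agrees with the
-- left-hand side at j = −L. The other indices pair off as j ↔ 1 − j, which flips the
-- sign of (j+1 / 3) and fixes kj(j−1); so, with m = L + j, it suffices that
--   [2L, m] + q^(2L+1−m) [2L, m−1] = [2L, m−1] + q^m [2L, m],
-- and both sides are [2L+1, m] by the two q-Pascal rules.

open import Defs
open import Level using (Level)
open import Data.Nat as ℕ using (ℕ; zero; suc; _≥_; z≤n; s≤s)
import Data.Nat.Properties as ℕₚ
open import Data.Nat.DivMod using (_%_; m%n<n; [m+n]%n≡m%n)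
open import Data.Integer as ℤ using (ℤ; +_; -[1+_]; +[1+_]; 0ℤ; 1ℤ; ∣_∣; +≤+)
import Data.Integer.Properties as ℤₚ
open import Data.Integer.DivMod using (_%ℕ_)
open import Data.Integer.Tactic.RingSolver using (solve-∀)
open import Relation.Binary.PropositionalEquality as ≡ using (_≡_; cong; subst)
open import Algebra.Bundles using (CommutativeRing)
import Algebra.Properties.Ring as RingProperties
import Algebra.Properties.CommutativeSemigroup as CommutativeSemigroupProperties
import Algebra.Solver.Ring.NaturalCoefficients.Default as NaturalCoefficientsSolver
import Relation.Binary.Reasoning.Setoid as SetoidReasoning

module GaussianBinomial {c ℓ : Level} (R : CommutativeRing c ℓ) (q : CommutativeRing.Carrier R) where
  open CommutativeRing R hiding (zero)
  open SetoidReasoning setoid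
  open NaturalCoefficientsSolver commutativeSemiring using (solve; _:+_; _:*_; _:=_; con)

  infix 10 q^_
  q^_ : ℕ → Carrier
  q^_ = pow R q

  q^-+ : ∀ m n → q^ (m ℕ.+ n) ≈ q^ m * q^ n
  q^-+ zero    n = sym (*-identityˡ _)
  q^-+ (suc m) n = trans (*-congˡ (q^-+ m n)) (sym (*-assoc _ _ _))

  qbin-above-diagonal : ∀ {n k} → n ℕ.< k → qbin R q n k ≈ 0#
  qbin-above-diagonal {zero}  {suc k} _         = refl
  qbin-above-diagonal {suc n} {suc k} (s≤s n<k) = begin
    qbin R q n k + q^ (suc k) * qbin R q n (suc k)
      ≈⟨ +-cong (qbin-above-diagonal n<k) (*-congˡ (qbin-above-diagonal (ℕₚ.m<n⇒m<1+n n<k))) ⟩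
    0# + q^ (suc k) * 0#
      ≈⟨ trans (+-identityˡ _) (zeroʳ _) ⟩
    0# ∎

  qbin-diagonal : ∀ n → qbin R q n n ≈ 1#
  qbin-diagonal zero    = refl
  qbin-diagonal (suc n) = begin
    qbin R q n n + q^ (suc n) * qbin R q n (suc n)
      ≈⟨ +-cong (qbin-diagonal n) (*-congˡ (qbin-above-diagonal (ℕₚ.n<1+n n))) ⟩
    1# + q^ (suc n) * 0#
      ≈⟨ trans (+-congˡ (zeroʳ _)) (+-identityʳ _) ⟩
    1# ∎

  gauss : ℕ → ℕ → Carrier
  gauss zero    b       = 1#
  gauss (suc a) zero    = 1#
  gauss (suc a) (suc b) = gauss a (suc b) + q^ (suc a) * gauss (suc a) b

  qbin≈gauss : ∀ a b → qbin R q (a ℕ.+ b) a ≈ gauss a b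
  qbin≈gauss zero    zero    = refl
  qbin≈gauss zero    (suc b) = refl
  qbin≈gauss (suc a) zero    =
    trans (reflexive (cong (λ n → qbin R q n (suc a)) (ℕₚ.+-identityʳ (suc a)))) (qbin-diagonal (suc a))
  qbin≈gauss (suc a) (suc b) = +-cong (qbin≈gauss a (suc b))
    (*-congˡ (trans (reflexive (cong (λ n → qbin R q n (suc a)) (ℕₚ.+-suc a b))) (qbin≈gauss (suc a) b)))

  -- The recursion defining gauss is the other q-Pascal rule.
  gauss-pascal′ : ∀ a b → gauss (suc a) (suc b) ≈ gauss (suc a) b + q^ (suc b) * gauss a (suc b)
  gauss-pascal′ zero    zero    = refl
  gauss-pascal′ (suc a) zero    = begin
    (g + P * 1#) + (q * P) * 1#   ≈⟨ +-congʳ (gauss-pascal′ a zero) ⟩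
    (1# + (q * 1#) * g) + (q * P) * 1#
      ≈⟨ solve 3 (λ q P g → (con 1 :+ (q :* con 1) :* g) :+ (q :* P) :* con 1
                          := con 1 :+ (q :* con 1) :* (g :+ P :* con 1)) refl q P g ⟩
    1# + (q * 1#) * (g + P * 1#) ∎
    where
    g = gauss a 1
    P = q^ (suc a)
  gauss-pascal′ zero    (suc b) = begin
    1# + (q * 1#) * gauss 1 (suc b)  ≈⟨ +-congˡ (*-congˡ (gauss-pascal′ zero b)) ⟩
    1# + (q * 1#) * (h + Q * 1#)
      ≈⟨ solve 3 (λ q Q h → con 1 :+ (q :* con 1) :* (h :+ Q :* con 1)
                          := (con 1 :+ (q :* con 1) :* h) :+ (q :* Q) :* con 1) refl q Q h ⟩
    (1# + (q * 1#) * h) + (q * Q) * 1# ∎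
    where
    h = gauss 1 b
    Q = q^ (suc b)
  gauss-pascal′ (suc a) (suc b) = begin
    (B + P * X) + (q * P) * (X + (q * P) * A)
      ≈⟨ +-congˡ (*-congˡ (gauss-pascal′ (suc a) b)) ⟩
    (B + P * X) + (q * P) * (A + Q * X)
      ≈⟨ +-congʳ (gauss-pascal′ a (suc b)) ⟩
    (X + (q * Q) * B) + (q * P) * (A + Q * X)
      ≈⟨ solve 6 (λ q P Q X A B → (X :+ (q :* Q) :* B) :+ (q :* P) :* (A :+ Q :* X)
                                := (X :+ (q :* P) :* A) :+ (q :* Q) :* (B :+ P :* X)) refl q P Q X A B ⟩
    (X + (q * P) * A) + (q * Q) * (B + P * X) ∎
    where
    X = gauss (suc a) (suc b)
    A = gauss (suc (suc a)) b
    B = gauss a (suc (suc b))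
    P = q^ (suc a)
    Q = q^ (suc b)

  gauss-sym : ∀ a b → gauss a b ≈ gauss b a
  gauss-sym zero    zero    = refl
  gauss-sym zero    (suc b) = refl
  gauss-sym (suc a) zero    = refl
  gauss-sym (suc a) (suc b) = begin
    gauss a (suc b) + q^ (suc a) * gauss (suc a) b
      ≈⟨ +-cong (gauss-sym a (suc b)) (*-congˡ (gauss-sym (suc a) b)) ⟩
    gauss (suc b) a + q^ (suc a) * gauss b (suc a)
      ≈⟨ sym (gauss-pascal′ b a) ⟩
    gauss (suc b) (suc a) ∎

module FiniteSums {c ℓ : Level} (R : CommutativeRing c ℓ) where
  open CommutativeRing R hiding (zero)
  open SetoidReasoning setoid
  open CommutativeSemigroupProperties +-commutativeSemigroup using (xy∙z≈xz∙y)

  sumTo : ℕ → (ℕ → Carrier) → Carrier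
  sumTo zero    u = 0#
  sumTo (suc n) u = sumTo n u + u n

  sumTo-unique : ∀ (g u : ℕ → Carrier) → g 0 ≡ 0# → (∀ n → g (suc n) ≡ g n + u n) →
                 ∀ n → g n ≡ sumTo n u
  sumTo-unique g u g0 gs zero    = g0
  sumTo-unique g u g0 gs (suc n) = ≡.trans (gs n) (cong (_+ u n) (sumTo-unique g u g0 gs n))

  -- The loop inside sumSym cannot be named; abstracting 2 * L exposes it applied
  -- to a variable, so unification recovers it as the g of sumTo-unique.
  sumSym≡sumTo : ∀ L f → sumSym R L f ≡ sumTo (suc (2 ℕ.* L)) (λ i → f (+ i ℤ.- + L))
  sumSym≡sumTo L f with sumTo-unique _ (λ i → f (+ i ℤ.- + L)) ≡.refl (λ _ → ≡.refl) | 2 ℕ.* L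
  ... | loop≡sumTo | n = cong (_+ f (+ n ℤ.- + L)) (loop≡sumTo n)

  *-distribˡ-sumTo : ∀ a n u → a * sumTo n u ≈ sumTo n (λ i → a * u i)
  *-distribˡ-sumTo a zero    u = zeroʳ a
  *-distribˡ-sumTo a (suc n) u = trans (distribˡ a _ _) (+-congʳ (*-distribˡ-sumTo a n u))

  sumTo-suc : ∀ n u → sumTo (suc n) u ≈ u 0 + sumTo n (λ i → u (suc i))
  sumTo-suc zero    u = trans (+-identityˡ _) (sym (+-identityʳ _))
  sumTo-suc (suc n) u = trans (+-congʳ (sumTo-suc n u)) (+-assoc _ _ _)

  sumTo-cong-pairs : ∀ M (u v : ℕ → Carrier) →
                     (∀ a b → suc (a ℕ.+ b) ≡ M ℕ.+ M → u a + u b ≈ v a + v b) →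
                     sumTo (M ℕ.+ M) u ≈ sumTo (M ℕ.+ M) v
  sumTo-cong-pairs zero    u v pairs = refl
  sumTo-cong-pairs (suc M) u v pairs rewrite ℕₚ.+-suc M M = begin
    sumTo (suc (M ℕ.+ M)) u + u last
      ≈⟨ +-congʳ (sumTo-suc (M ℕ.+ M) u) ⟩
    (u 0 + sumTo (M ℕ.+ M) (λ i → u (suc i))) + u last
      ≈⟨ xy∙z≈xz∙y _ _ _ ⟩
    (u 0 + u last) + sumTo (M ℕ.+ M) (λ i → u (suc i))
      ≈⟨ +-cong (pairs 0 last ≡.refl) (sumTo-cong-pairs M _ _ inner-pairs) ⟩
    (v 0 + v last) + sumTo (M ℕ.+ M) (λ i → v (suc i))
      ≈⟨ xy∙z≈xz∙y _ _ _ ⟩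
    (v 0 + sumTo (M ℕ.+ M) (λ i → v (suc i))) + v last
      ≈⟨ +-congʳ (sym (sumTo-suc (M ℕ.+ M) v)) ⟩
    sumTo (suc (M ℕ.+ M)) v + v last ∎
    where
    last = suc (M ℕ.+ M)
    inner-pairs : ∀ a b → suc (a ℕ.+ b) ≡ M ℕ.+ M → u (suc a) + u (suc b) ≈ v (suc a) + v (suc b)
    inner-pairs a b eq = pairs (suc a) (suc b) (cong (λ n → suc (suc n)) (≡.trans (ℕₚ.+-suc a b) eq))

2*n≡n+n : ∀ n → 2 ℕ.* n ≡ n ℕ.+ n
2*n≡n+n n = cong (n ℕ.+_) (ℕₚ.+-identityʳ n)

lhsExponent : ℕ → ℤ → ℤ
lhsExponent k j = + k ℤ.* j ℤ.* (j ℤ.- 1ℤ)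

rhsExponent : ℕ → ℤ → ℤ
rhsExponent k j = + k ℤ.* j ℤ.* j ℤ.- (+ k ℤ.- 1ℤ) ℤ.* j

nonNeg-+ : ∀ {i j} → 0ℤ ℤ.≤ i → 0ℤ ℤ.≤ j → 0ℤ ℤ.≤ i ℤ.+ j
nonNeg-+ (+≤+ _) (+≤+ _) = +≤+ z≤n

nonNeg-* : ∀ {i j} → 0ℤ ℤ.≤ i → 0ℤ ℤ.≤ j → 0ℤ ℤ.≤ i ℤ.* j
nonNeg-* {+ m} {+ n} _ _ = subst (0ℤ ℤ.≤_) (ℤₚ.pos-* m n) (+≤+ z≤n)

i*i-nonNeg : ∀ i → 0ℤ ℤ.≤ i ℤ.* i
i*i-nonNeg (+ n)    = nonNeg-* {+ n} {+ n} (+≤+ z≤n) (+≤+ z≤n)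
i*i-nonNeg -[1+ n ] = +≤+ z≤n

i*[i-1]-nonNeg : ∀ i → 0ℤ ℤ.≤ i ℤ.* (i ℤ.- 1ℤ)
i*[i-1]-nonNeg (+ zero)  = +≤+ z≤n
i*[i-1]-nonNeg +[1+ n ]  = nonNeg-* {+[1+ n ]} {+ n} (+≤+ z≤n) (+≤+ z≤n)
i*[i-1]-nonNeg -[1+ n ]  = +≤+ z≤n

lhsExponent-nonNeg : ∀ k j → 0ℤ ℤ.≤ lhsExponent k j
lhsExponent-nonNeg k j = subst (0ℤ ℤ.≤_) (≡.sym (reassoc (+ k) j))
                                (nonNeg-* {+ k} (+≤+ z≤n) (i*[i-1]-nonNeg j))
  where
  reassoc : ∀ k j → k ℤ.* j ℤ.* (j ℤ.- 1ℤ) ≡ k ℤ.* (j ℤ.* (j ℤ.- 1ℤ))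
  reassoc = solve-∀

rhsExponent-nonNeg : ∀ k j → 0ℤ ℤ.≤ rhsExponent (suc k) j
rhsExponent-nonNeg k j = subst (0ℤ ℤ.≤_) (≡.sym (split (+ k) j))
                                (nonNeg-+ (nonNeg-* {+ k} (+≤+ z≤n) (i*[i-1]-nonNeg j)) (i*i-nonNeg j))
  where
  split : ∀ k j → (1ℤ ℤ.+ k) ℤ.* j ℤ.* j ℤ.- ((1ℤ ℤ.+ k) ℤ.- 1ℤ) ℤ.* j ≡ k ℤ.* (j ℤ.* (j ℤ.- 1ℤ)) ℤ.+ j ℤ.* j
  split = solve-∀

∣∣-+-injective : ∀ {a b m n} → 0ℤ ℤ.≤ a → 0ℤ ℤ.≤ b → a ℤ.+ + m ≡ b ℤ.+ + n → ∣ a ∣ ℕ.+ m ≡ ∣ b ∣ ℕ.+ n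
∣∣-+-injective (+≤+ _) (+≤+ _) eq = ℤₚ.+-injective eq

rhsExponent+L≡lhsExponent+i : ∀ k L i → let j = + i ℤ.- + L in
  ∣ rhsExponent (suc k) j ∣ ℕ.+ L ≡ ∣ lhsExponent (suc k) j ∣ ℕ.+ i
rhsExponent+L≡lhsExponent+i k L i =
  ∣∣-+-injective (rhsExponent-nonNeg k j) (lhsExponent-nonNeg (suc k) j) (shift (+ suc k) (+ i) (+ L))
  where
  j = + i ℤ.- + L
  shift : ∀ k i L → let j = i ℤ.- L in
    (k ℤ.* j ℤ.* j ℤ.- (k ℤ.- 1ℤ) ℤ.* j) ℤ.+ L ≡ k ℤ.* j ℤ.* (j ℤ.- 1ℤ) ℤ.+ i
  shift = solve-∀

lhsExponent-reflect : ∀ k j → lhsExponent k (1ℤ ℤ.- j) ≡ lhsExponent k j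
lhsExponent-reflect k j = reflect (+ k) j
  where
  reflect : ∀ k j → k ℤ.* (1ℤ ℤ.- j) ℤ.* ((1ℤ ℤ.- j) ℤ.- 1ℤ) ≡ k ℤ.* j ℤ.* (j ℤ.- 1ℤ)
  reflect = solve-∀

∣L-[i-L]∣≡m : ∀ L i m → m ℕ.+ i ≡ L ℕ.+ L → ∣ + L ℤ.- (+ i ℤ.- + L) ∣ ≡ m
∣L-[i-L]∣≡m L i m eq = cong ∣_∣ (begin
  + L ℤ.- (+ i ℤ.- + L)    ≡⟨ regroup (+ L) (+ i) ⟩
  + (L ℕ.+ L) ℤ.- + i      ≡⟨ cong (λ n → + n ℤ.- + i) (≡.sym eq) ⟩
  + (m ℕ.+ i) ℤ.- + i      ≡⟨ cancel (+ m) (+ i) ⟩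
  + m                      ∎)
  where
  open ≡.≡-Reasoning
  regroup : ∀ L i → L ℤ.- (i ℤ.- L) ≡ (L ℤ.+ L) ℤ.- i
  regroup = solve-∀
  cancel : ∀ m i → (m ℤ.+ i) ℤ.- i ≡ m
  cancel = solve-∀

[1+b]-L≡1-[[1+a]-L] : ∀ L a b → suc (a ℕ.+ b) ≡ L ℕ.+ L →
                      + suc b ℤ.- + L ≡ 1ℤ ℤ.- (+ suc a ℤ.- + L)
[1+b]-L≡1-[[1+a]-L] L a b eq = begin
  + suc b ℤ.- + L                          ≡⟨ regroup (+ a) (+ b) (+ L) ⟩
  + suc (a ℕ.+ b) ℤ.- + a ℤ.- + L          ≡⟨ cong (λ n → + n ℤ.- + a ℤ.- + L) eq ⟩
  + (L ℕ.+ L) ℤ.- + a ℤ.- + L              ≡⟨ cancel (+ a) (+ L) ⟩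
  1ℤ ℤ.- (+ suc a ℤ.- + L)                 ∎
  where
  open ≡.≡-Reasoning
  regroup : ∀ a b L → (1ℤ ℤ.+ b) ℤ.- L ≡ (1ℤ ℤ.+ (a ℤ.+ b)) ℤ.- a ℤ.- L
  regroup = solve-∀
  cancel : ∀ a L → (L ℤ.+ L) ℤ.- a ℤ.- L ≡ 1ℤ ℤ.- ((1ℤ ℤ.+ a) ℤ.- L)
  cancel = solve-∀

module JacobiSymbol {c ℓ : Level} (R : CommutativeRing c ℓ) where
  open CommutativeRing R hiding (zero)
  open RingProperties ring using (-0#≈0#; -‿involutive)

  jac3-neg : ∀ s → jac3 R -[1+ s ] ≈ - jac3 R (+ suc s)
  jac3-neg s with suc s % 3 | m%n<n (suc s) 3
  ... | 0 | _ = sym -0#≈0#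
  ... | 1 | _ = refl
  ... | 2 | _ = sym (-‿involutive 1#)
  ... | suc (suc (suc _)) | s≤s (s≤s (s≤s ()))

  jac3-periodic : ∀ t → jac3 R (+ (3 ℕ.+ t)) ≡ jac3 R (+ t)
  jac3-periodic t = residue-cong (+ (3 ℕ.+ t)) (+ t) (≡.trans (cong (_% 3) (ℕₚ.+-comm 3 t)) ([m+n]%n≡m%n t 3))
    where
    residue-cong : ∀ a b → a %ℕ 3 ≡ b %ℕ 3 → jac3 R a ≡ jac3 R b
    residue-cong a b eq rewrite eq = ≡.refl

  jac3-reflect : ∀ y → jac3 R (+ 3 ℤ.- y) ≈ - jac3 R y
  jac3-reflect (+ 0)                   = sym -0#≈0#
  jac3-reflect (+ 1)                   = refl
  jac3-reflect (+ 2)                   = sym (-‿involutive 1#)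
  jac3-reflect (+ 3)                   = sym -0#≈0#
  jac3-reflect (+ suc (suc (suc (suc s)))) =
    trans (jac3-neg s) (-‿cong (reflexive (≡.sym (jac3-periodic (suc s)))))
  jac3-reflect -[1+ n ]                =
    trans (reflexive (jac3-periodic (suc n))) (trans (sym (-‿involutive _)) (-‿cong (sym (jac3-neg n))))

module Differences {r ℓ : Level} (R : CommutativeRing r ℓ) where
  open CommutativeRing R hiding (zero)
  open SetoidReasoning setoid
  open NaturalCoefficientsSolver commutativeSemiring using (solve; _:+_; _:*_; _:=_)

  scaled-difference-cong : ∀ c X Y X′ Y′ → X + Y′ ≈ Y + X′ → c * X + (- c) * Y ≈ c * X′ + (- c) * Y′
  scaled-difference-cong c X Y X′ Y′ hyp = begin
    c * X + (- c) * Y                          ≈⟨ sym (+-identityʳ _) ⟩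
    (c * X + (- c) * Y) + 0#                   ≈⟨ +-congˡ (sym (c-c≈0 Y′)) ⟩
    (c * X + (- c) * Y) + (c + - c) * Y′
      ≈⟨ solve 6 (λ c c′ X Y X′ Y′ → (c :* X :+ c′ :* Y) :+ (c :+ c′) :* Y′ := c :* (X :+ Y′) :+ c′ :* (Y :+ Y′))
               refl c (- c) X Y X′ Y′ ⟩
    c * (X + Y′) + (- c) * (Y + Y′)            ≈⟨ +-congʳ (*-congˡ hyp) ⟩
    c * (Y + X′) + (- c) * (Y + Y′)
      ≈⟨ solve 6 (λ c c′ X Y X′ Y′ → c :* (Y :+ X′) :+ c′ :* (Y :+ Y′) := (c :* X′ :+ c′ :* Y′) :+ (c :+ c′) :* Y)
               refl c (- c) X Y X′ Y′ ⟩
    (c * X′ + (- c) * Y′) + (c + - c) * Y      ≈⟨ +-congˡ (c-c≈0 Y) ⟩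
    (c * X′ + (- c) * Y′) + 0#                 ≈⟨ +-identityʳ _ ⟩
    c * X′ + (- c) * Y′ ∎
    where
    c-c≈0 : ∀ Z → (c + - c) * Z ≈ 0#
    c-c≈0 Z = trans (*-congʳ (-‿inverseʳ c)) (zeroˡ Z)

module Summands {r ℓ : Level} (R : CommutativeRing r ℓ) (q : CommutativeRing.Carrier R) (L k : ℕ) where
  open CommutativeRing R hiding (zero)
  open SetoidReasoning setoid
  open NaturalCoefficientsSolver commutativeSemiring using (solve; _:*_; _:=_)
  open RingProperties ring using (-‿distribˡ-*)
  open GaussianBinomial R q
  open JacobiSymbol R
  open Differences R

  j : ℕ → ℤ
  j i = + i ℤ.- + L

  χ : ℕ → Carrier
  χ i = jac3 R (j i ℤ.+ 1ℤ)

  e : ℕ → ℕ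
  e i = ∣ lhsExponent (suc k) (j i) ∣

  binomial : ℕ → Carrier
  binomial i = qbin R q (2 ℕ.* L) ∣ + L ℤ.- j i ∣

  lhsTerm : ℕ → Carrier
  lhsTerm i = χ i * q^ e i * binomial i

  rhsTerm : ℕ → Carrier
  rhsTerm i = χ i * q^ ∣ rhsExponent (suc k) (j i) ∣ * binomial i

  binomial≈gauss : ∀ i m → m ℕ.+ i ≡ L ℕ.+ L → binomial i ≈ gauss m i
  binomial≈gauss i m eq = trans
    (reflexive (≡.cong₂ (qbin R q) (≡.trans (2*n≡n+n L) (≡.sym eq)) (∣L-[i-L]∣≡m L i m eq)))
    (qbin≈gauss m i)

  q^L*rhsTerm : ∀ i → q^ L * rhsTerm i ≈ χ i * q^ e i * (q^ i * binomial i)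
  q^L*rhsTerm i = begin
    q^ L * (χ i * q^ x * binomial i)
      ≈⟨ solve 4 (λ a b c d → a :* (b :* c :* d) := b :* (a :* c) :* d) refl (q^ L) (χ i) (q^ x) (binomial i) ⟩
    χ i * (q^ L * q^ x) * binomial i
      ≈⟨ *-congʳ (*-congˡ shift) ⟩
    χ i * (q^ e i * q^ i) * binomial i
      ≈⟨ solve 4 (λ a b c d → a :* (b :* c) :* d := a :* b :* (c :* d)) refl (χ i) (q^ e i) (q^ i) (binomial i) ⟩
    χ i * q^ e i * (q^ i * binomial i) ∎
    where
    x = ∣ rhsExponent (suc k) (j i) ∣
    shift : q^ L * q^ x ≈ q^ e i * q^ i
    shift = trans (sym (q^-+ L x))
      (trans (reflexive (cong q^_ (≡.trans (ℕₚ.+-comm L x) (rhsExponent+L≡lhsExponent+i k L i)))) (q^-+ (e i) i))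

  χ-reflect : ∀ i i′ → j i′ ≡ 1ℤ ℤ.- j i → χ i′ ≈ - χ i
  χ-reflect i i′ eq = trans (reflexive (cong (jac3 R) (≡.trans (cong (ℤ._+ 1ℤ) eq) (regroup (j i)))))
                            (jac3-reflect (j i ℤ.+ 1ℤ))
    where
    regroup : ∀ j → (1ℤ ℤ.- j) ℤ.+ 1ℤ ≡ + 3 ℤ.- (j ℤ.+ 1ℤ)
    regroup = solve-∀

  e-reflect : ∀ i i′ → j i′ ≡ 1ℤ ℤ.- j i → e i′ ≡ e i
  e-reflect i i′ eq = cong ∣_∣ (≡.trans (cong (lhsExponent (suc k)) eq) (lhsExponent-reflect (suc k) (j i)))

  lhsTerm-head : lhsTerm 0 ≈ q^ L * rhsTerm 0
  lhsTerm-head = sym (trans (q^L*rhsTerm 0) (*-congˡ (*-identityˡ _)))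

  lhsTerm-pair : ∀ a b → suc (a ℕ.+ b) ≡ L ℕ.+ L →
                 lhsTerm (suc a) + lhsTerm (suc b) ≈ q^ L * rhsTerm (suc a) + q^ L * rhsTerm (suc b)
  lhsTerm-pair a b eq = begin
    lhsTerm (suc a) + lhsTerm (suc b)
      ≈⟨ +-cong (*-congˡ X≈) (*-cong c′≈-c Y≈) ⟩
    c * X + (- c) * Y
      ≈⟨ scaled-difference-cong c X Y _ _ (sym (gauss-pascal′ a b)) ⟩
    c * (q^ (suc a) * X) + (- c) * (q^ (suc b) * Y)
      ≈⟨ sym (+-cong (trans (q^L*rhsTerm (suc a)) (*-congˡ (*-congˡ X≈)))
                     (trans (q^L*rhsTerm (suc b)) (*-cong c′≈-c (*-congˡ Y≈)))) ⟩
    q^ L * rhsTerm (suc a) + q^ L * rhsTerm (suc b) ∎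
    where
    c = χ (suc a) * q^ e (suc a)
    X = gauss (suc a) b
    Y = gauss a (suc b)
    X≈ : binomial (suc a) ≈ X
    X≈ = trans (binomial≈gauss (suc a) b (≡.trans (ℕₚ.+-suc b a) (≡.trans (cong suc (ℕₚ.+-comm b a)) eq)))
               (gauss-sym b (suc a))
    Y≈ : binomial (suc b) ≈ Y
    Y≈ = binomial≈gauss (suc b) a (≡.trans (ℕₚ.+-suc a b) eq)
    reflected : j (suc b) ≡ 1ℤ ℤ.- j (suc a)
    reflected = [1+b]-L≡1-[[1+a]-L] L a b eq
    c′≈-c : χ (suc b) * q^ e (suc b) ≈ - c
    c′≈-c = trans (*-cong (χ-reflect (suc a) (suc b) reflected) (reflexive (cong q^_ (e-reflect (suc a) (suc b) reflected))))
                  (sym (-‿distribˡ-* _ _))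

theorem12 : ∀ {c ℓ : Level} (R : CommutativeRing c ℓ) (q : CommutativeRing.Carrier R)
            (L k : ℕ) → k ≥ 1 →
            CommutativeRing._≈_ R (lhs12 R q L k) (rhs12 R q L k)
theorem12 R q L (suc k) _ = begin
  lhs12 R q L (suc k)                                ≡⟨ sumSym≡sumTo L _ ⟩
  sumTo (suc (2 ℕ.* L)) lhsTerm                      ≡⟨ cong (λ n → sumTo (suc n) lhsTerm) (2*n≡n+n L) ⟩
  sumTo (suc (L ℕ.+ L)) lhsTerm                      ≈⟨ sumTo-suc (L ℕ.+ L) lhsTerm ⟩
  lhsTerm 0 + sumTo (L ℕ.+ L) (λ i → lhsTerm (suc i))
    ≈⟨ +-cong lhsTerm-head (sumTo-cong-pairs L _ _ lhsTerm-pair) ⟩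
  shifted 0 + sumTo (L ℕ.+ L) (λ i → shifted (suc i)) ≈⟨ sym (sumTo-suc (L ℕ.+ L) shifted) ⟩
  sumTo (suc (L ℕ.+ L)) shifted                      ≡⟨ cong (λ n → sumTo (suc n) shifted) (≡.sym (2*n≡n+n L)) ⟩
  sumTo (suc (2 ℕ.* L)) shifted                      ≈⟨ sym (*-distribˡ-sumTo (q^ L) (suc (2 ℕ.* L)) rhsTerm) ⟩
  q^ L * sumTo (suc (2 ℕ.* L)) rhsTerm               ≡⟨ cong (q^ L *_) (≡.sym (sumSym≡sumTo L _)) ⟩
  rhs12 R q L (suc k)                                ∎
  where
  open CommutativeRing R hiding (zero)
  open SetoidReasoning setoid
  open FiniteSums R
  open GaussianBinomial R q using (q^_)
  open Summands R q L k using (lhsTerm; rhsTerm; lhsTerm-head; lhsTerm-pair)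
  shifted : ℕ → Carrier
  shifted i = q^ L * rhsTerm i
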